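{- Let $q\ge2$ and $n\ge1$ be integers. Under each of the scenarios $(*\bullet)$ and $(\bullet\bullet)$, the family $\mathcal{G}_q\cup\mathcal{L}_q$ is $n$-cell implementable if and only if $q\le 2n$, where $\mathcal{G}_q=\{x\mapsto[\![x\ge t]\!]\}_{t\in[q\rangle}$ and $\mathcal{L}_q=\{x\mapsto[\![x\le t]\!]\}_{t\in[q\rangle}$.
   Context: $[b\rangle=\{0,1,\ldots,b-1\}$. Let $\mathbb{B}=\{0,1\}$, $\mathbb{B}_\circ=\mathbb{B}$, $\mathbb{B}_*=\mathbb{B}\cup\{*\}$, $\mathbb{B}_\bullet=\mathbb{B}\cup\{*,\bullet\}$. Define $\mathrm{T}:\mathbb{B}_\bullet^2\to\mathbb{B}$ by $\mathrm{T}(u,\vartheta)=1$ if and only if $u=*$, or $\vartheta=*$, or $u=\vartheta\in\mathbb{B}$. $[\![\cdot]\!]$ is the Iverson bracket. $\mathcal{F}_q$ is the set of all functions $[q\rangle\to\mathbb{B}$. For $\alpha,\beta\in\{\circ,*,\bullet\}$, a subset $\Phi\subseteq\mathcal{F}_q$ is $n$-cell implementable under scenario $(\alpha\beta)$ if there exist mappings $\mathbf{u}=(u_j)_{j\in[n\rangle}:[q\rangle\to\mathbb{B}_\alpha^n$ and $\boldsymbol{\vartheta}=(\vartheta_j)_{j\in[n\rangle}:\Phi\to\mathbb{B}_\beta^n$ such that $f(x)=\bigwedge_{j\in[n\rangle}\mathrm{T}(u_j(x),\vartheta_j(f))$ for all $f\in\Phi$ and $x\in[q\rangle$. -}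

module Defs where

open import Data.Nat using (ℕ; zero; suc; _≤_; _≤ᵇ_)
open import Data.Fin using (Fin; toℕ)
open import Data.Bool using (Bool; true; false; _∧_)
open import Data.Product using (Σ; ∃; _×_)
open import Data.Sum using (_⊎_)
open import Relation.Binary.PropositionalEquality using (_≡_)

data Cell : Set where
  bit    : Bool → Cell
  star   : Cell
  bullet : Cell

data Scen : Set where
  ∘s *s •s : Scen

data InScen : Scen → Cell → Set where
  ∘-bit : ∀ b → InScen ∘s (bit b)
  *-bit : ∀ b → InScen *s (bit b)
  *-star : InScen *s star
  •-bit : ∀ b → InScen •s (bit b)
  •-star : InScen •s star
  •-bullet : InScen •s bullet

T : Cell → Cell → Bool
T star _ = true
T (bit _) star = true
T bullet star = true
T (bit true) (bit true) = true
T (bit false) (bit false) = true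
T _ _ = false

bigAnd : (n : ℕ) → (Fin n → Bool) → Bool
bigAnd zero g = true
bigAnd (suc n) g = g Fin.zero ∧ bigAnd n (λ j → g (Fin.suc j))

Func : ℕ → Set
Func q = Fin q → Bool

Implementable : Scen → Scen → (q n : ℕ) → (Func q → Set) → Set
Implementable α β q n Φ =
  Σ (Fin q → Fin n → Cell) λ u →
  Σ ((f : Func q) → Φ f → Fin n → Cell) λ ϑ →
    ((x : Fin q) (j : Fin n) → InScen α (u x j)) ×
    ((f : Func q) (p : Φ f) (j : Fin n) → InScen β (ϑ f p j)) ×
    ((f : Func q) (p : Φ f) (x : Fin q) →
       f x ≡ bigAnd n (λ j → T (u x j) (ϑ f p j)))

GL : (q : ℕ) → Func q → Set
GL q f = ∃ λ (t : Fin q) →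
  ((∀ x → f x ≡ (toℕ t ≤ᵇ toℕ x)) ⊎ (∀ x → f x ≡ (toℕ x ≤ᵇ toℕ t)))

{-# OPTIONS --safe #-}
-- Necessity: implementing y ↦ [y ≥ x+1] (or y ↦ [y ≤ 0] for the largest x), some cell j rejects
-- x under a key that all larger inputs pass. Such a key is a bit b, each larger input stores
-- the bit b in cell j, and x carries the label ¬b there, so x ↦ (j, label) is injective into [n⟩ × 𝔹 and q ≤ 2n.
-- Sufficiency: cell j stores the inputs 2j and 2j+1 as the bits 0 and 1 (and * elsewhere),
-- and a threshold function is encoded by requiring the right bit in the cell of its threshold.
module Submission where

open import Defs
open import Data.Nat using (ℕ; zero; suc; _+_; _*_; _≤_; _<_; _≤ᵇ_; _≤?_; _<?_; z≤n; s≤s; ⌊_/2⌋)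
open import Data.Nat.Properties
  using (≤ᵇ⇒≤; ≤⇒≤ᵇ; ≰⇒>; ≮⇒≥; <⇒≱; ≤-pred; ≤-trans; <-≤-trans; <-cmp; n<1+n; +-suc; *-comm)
open import Data.Fin using (Fin; toℕ; fromℕ<)
open import Data.Fin.Properties using (toℕ-fromℕ<; toℕ-injective; toℕ<n; injective⇒≤; *↔×; 2↔Bool)
open import Data.Bool using (Bool; true; false; not)
open import Data.Bool.Properties using (not-¬; T-≡)
open import Data.Product using (Σ; ∃; _×_; _,_; proj₁; proj₂)
open import Data.Product.Function.NonDependent.Propositional using (_×-↣_)
open import Data.Sum using (inj₁; inj₂)
open import Data.Empty using (⊥-elim)
open import Relation.Nullary using (yes; no)
open import Relation.Binary.PropositionalEquality using (_≡_; _≢_; refl; sym; trans; cong; subst)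
open import Relation.Binary.Definitions using (tri<; tri≈; tri>)
open import Function.Base using (_∘_)
open import Function.Bundles using (_⇔_; _↣_; Injection; Equivalence; mk⇔)
open import Function.Definitions using (Injective)
open import Function.Construct.Composition using (_↣-∘_)
open import Function.Construct.Identity using (↣-id)
open import Function.Construct.Symmetry using (↔-sym)
open import Function.Properties.Inverse using (↔⇒↣)

≤ᵇ≡true : ∀ {m k} → m ≤ k → (m ≤ᵇ k) ≡ true
≤ᵇ≡true m≤k = Equivalence.to T-≡ (≤⇒≤ᵇ m≤k)

≤ᵇ≡false : ∀ {m k} → k < m → (m ≤ᵇ k) ≡ false
≤ᵇ≡false {m} {k} k<m with m ≤ᵇ k in eq
... | false = refl
... | true  = ⊥-elim (<⇒≱ k<m (≤ᵇ⇒≤ m k (Equivalence.from T-≡ eq)))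

bigAnd≡true⇒ : ∀ n (g : Fin n → Bool) → bigAnd n g ≡ true → ∀ j → g j ≡ true
bigAnd≡true⇒ (suc n) g e j with g Fin.zero in g₀
bigAnd≡true⇒ (suc n) g e Fin.zero    | true = g₀
bigAnd≡true⇒ (suc n) g e (Fin.suc j) | true = bigAnd≡true⇒ n (g ∘ Fin.suc) e j

⇒bigAnd≡true : ∀ n (g : Fin n → Bool) → (∀ j → g j ≡ true) → bigAnd n g ≡ true
⇒bigAnd≡true zero    g all = refl
⇒bigAnd≡true (suc n) g all rewrite all Fin.zero = ⇒bigAnd≡true n (g ∘ Fin.suc) (all ∘ Fin.suc)

bigAnd≡false⇒ : ∀ n (g : Fin n → Bool) → bigAnd n g ≡ false → ∃ λ j → g j ≡ false
bigAnd≡false⇒ (suc n) g e with g Fin.zero in g₀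
... | false = Fin.zero , g₀
... | true with j , gj ← bigAnd≡false⇒ n (g ∘ Fin.suc) e = Fin.suc j , gj

⇒bigAnd≡false : ∀ n (g : Fin n → Bool) j → g j ≡ false → bigAnd n g ≡ false
⇒bigAnd≡false (suc n) g Fin.zero    gj rewrite gj = refl
⇒bigAnd≡false (suc n) g (Fin.suc j) gj with g Fin.zero
... | false = refl
... | true  = ⇒bigAnd≡false n (g ∘ Fin.suc) j gj

T-star : ∀ u → T u star ≡ true
T-star (bit _) = refl
T-star star    = refl
T-star bullet  = refl

≥-indicator ≤-indicator : ∀ {q} → Fin q → Func q
≥-indicator t x = toℕ t ≤ᵇ toℕ x
≤-indicator t x = toℕ x ≤ᵇ toℕ t

GL-separates : ∀ {q} → 2 ≤ q → (x : Fin q) →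
  Σ (Func q) λ f → GL q f × f x ≡ false × (∀ y → toℕ x < toℕ y → f y ≡ true)
GL-separates {q} 2≤q x with suc (toℕ x) <? q
... | yes x+1<q = ≥-indicator t , (t , inj₁ λ _ → refl) , rejects , accepts
  where
    t = fromℕ< x+1<q
    rejects : ≥-indicator t x ≡ false
    rejects rewrite toℕ-fromℕ< x+1<q = ≤ᵇ≡false (n<1+n (toℕ x))
    accepts : ∀ y → toℕ x < toℕ y → ≥-indicator t y ≡ true
    accepts y x<y rewrite toℕ-fromℕ< x+1<q = ≤ᵇ≡true x<y
... | no x+1≮q = ≤-indicator t , (t , inj₂ λ _ → refl) , rejects , nothing-above
  where
    q≤x+1 = ≮⇒≥ x+1≮q
    0<q = <-≤-trans (s≤s z≤n) 2≤q
    t = fromℕ< 0<q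
    rejects : ≤-indicator t x ≡ false
    rejects rewrite toℕ-fromℕ< 0<q = ≤ᵇ≡false (≤-pred (≤-trans 2≤q q≤x+1))
    nothing-above : ∀ y → toℕ x < toℕ y → ≤-indicator t y ≡ true
    nothing-above y x<y = ⊥-elim (<⇒≱ (toℕ<n y) (≤-trans q≤x+1 x<y))

-- Meant for a cell value u rejecting the key ϑ; the last clause is junk.
rejectionLabel : Cell → Cell → Bool
rejectionLabel (bit c) _       = c
rejectionLabel _       (bit b) = not b
rejectionLabel _       _       = false

rejectionLabel-rejected : ∀ u b → T u (bit b) ≡ false → rejectionLabel u (bit b) ≡ not b
rejectionLabel-rejected (bit true)  false _ = refl
rejectionLabel-rejected (bit false) true  _ = refl
rejectionLabel-rejected bullet      b     _ = refl
rejectionLabel-rejected (bit true)  true  ()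
rejectionLabel-rejected (bit false) false ()
rejectionLabel-rejected star        b     ()

rejectionLabel-accepted : ∀ u ϑ b → T u (bit b) ≡ true → T u ϑ ≡ false → rejectionLabel u ϑ ≡ b
rejectionLabel-accepted (bit true)  ϑ true  _ _ = refl
rejectionLabel-accepted (bit false) ϑ false _ _ = refl
rejectionLabel-accepted (bit true)  ϑ false ()
rejectionLabel-accepted (bit false) ϑ true  ()
rejectionLabel-accepted bullet      ϑ b     ()
rejectionLabel-accepted star        ϑ b     _ ()

separating-key-is-bit : ∀ u v ϑ ϑ′ → T u ϑ ≡ false → T v ϑ ≡ true → T v ϑ′ ≡ false →
  ∃ λ b → ϑ ≡ bit b
separating-key-is-bit u v (bit b) ϑ′ _ _ _ = b , refl
separating-key-is-bit (bit _) v star ϑ′ ()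
separating-key-is-bit star    v star ϑ′ ()
separating-key-is-bit bullet  v star ϑ′ ()
separating-key-is-bit u (bit _) bullet ϑ′ _ ()
separating-key-is-bit u bullet bullet ϑ′ _ ()
separating-key-is-bit u star bullet ϑ′ _ _ ()

rejectionLabel-separates : ∀ u v ϑ ϑ′ → T u ϑ ≡ false → T v ϑ ≡ true → T v ϑ′ ≡ false →
  rejectionLabel u ϑ ≢ rejectionLabel v ϑ′
rejectionLabel-separates u v ϑ ϑ′ u✗ϑ v✓ϑ v✗ϑ′ same
  with b , refl ← separating-key-is-bit u v ϑ ϑ′ u✗ϑ v✓ϑ v✗ϑ′ =
  not-¬ refl (trans (sym (rejectionLabel-accepted v ϑ′ b v✓ϑ v✗ϑ′))
             (trans (sym same) (rejectionLabel-rejected u b u✗ϑ)))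

↣Fin×Bool⇒≤ : ∀ {q n} → Fin q ↣ (Fin n × Bool) → q ≤ n * 2
↣Fin×Bool⇒≤ {n = n} ι = injective⇒≤ (Injection.injective toFin)
  where
    toFin = ↔⇒↣ (↔-sym *↔×) ↣-∘ ((↣-id (Fin n) ×-↣ ↔⇒↣ (↔-sym 2↔Bool)) ↣-∘ ι)

record Rejection {q n} (u : Fin q → Fin n → Cell) (x : Fin q) : Set where
  field
    cell          : Fin n
    key           : Cell
    rejects       : T (u x cell) key ≡ false
    accepts-above : ∀ y → toℕ x < toℕ y → T (u y cell) key ≡ true

  label : Bool
  label = rejectionLabel (u x cell) key

Rejection-separates : ∀ {q n u} {x y : Fin q} → toℕ x < toℕ y →
  (ρ : Rejection {q} {n} u x) (σ : Rejection u y) →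
  Rejection.cell ρ ≡ Rejection.cell σ → Rejection.label ρ ≢ Rejection.label σ
Rejection-separates {y = y} x<y
  record { cell = j ; key = ϑ ; rejects = x✗ϑ ; accepts-above = above✓ϑ }
  record { key = ϑ′ ; rejects = y✗ϑ′ } refl =
  rejectionLabel-separates _ _ ϑ ϑ′ x✗ϑ (above✓ϑ y x<y) y✗ϑ′

rejections⇒≤ : ∀ {q n} (u : Fin q → Fin n → Cell) → (∀ x → Rejection u x) → q ≤ n * 2
rejections⇒≤ {q} {n} u ρ = ↣Fin×Bool⇒≤ (record { to = code ; cong = cong code ; injective = injective })
  where
    open Rejection

    code : Fin q → Fin n × Bool
    code x = cell (ρ x) , label (ρ x)

    no-clash : ∀ x y → toℕ x < toℕ y → code x ≢ code y
    no-clash x y x<y same = Rejection-separates x<y (ρ x) (ρ y) (cong proj₁ same) (cong proj₂ same)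

    injective : Injective _≡_ _≡_ code
    injective {x} {y} same with <-cmp (toℕ x) (toℕ y)
    ... | tri< x<y _ _ = ⊥-elim (no-clash x y x<y same)
    ... | tri≈ _ x≡y _ = toℕ-injective x≡y
    ... | tri> _ _ y<x = ⊥-elim (no-clash y x y<x (sym same))

Implementable-GL⇒Rejection : ∀ {α β q n} → 2 ≤ q → (imp : Implementable α β q n (GL q)) →
  ∀ x → Rejection (proj₁ imp) x
Implementable-GL⇒Rejection {n = n} 2≤q (u , ϑ , _ , _ , implements) x
  with f , f∈GL , fx≡false , f-above ← GL-separates 2≤q x
  with j , x✗ ← bigAnd≡false⇒ n _ (trans (sym (implements f f∈GL x)) fx≡false) =
  record
    { cell          = j
    ; key           = ϑ f f∈GL j
    ; rejects       = x✗
    ; accepts-above = λ y x<y →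
        bigAnd≡true⇒ n _ (trans (sym (implements f f∈GL y)) (f-above y x<y)) j
    }

Implementable-GL⇒≤ : ∀ {α β q n} → 2 ≤ q → Implementable α β q n (GL q) → q ≤ 2 * n
Implementable-GL⇒≤ {n = n} 2≤q imp rewrite *-comm 2 n =
  rejections⇒≤ (proj₁ imp) (Implementable-GL⇒Rejection 2≤q imp)

encode : ℕ → ℕ → Cell
encode 0             0       = bit false
encode 1             0       = bit true
encode (suc (suc _)) 0       = star
encode 0             (suc _) = star
encode 1             (suc _) = star
encode (suc (suc x)) (suc j) = encode x j

-- The key of x ↦ [x ≥ t] in cell j is • when both inputs 2j, 2j+1 of the cell lie below t,
-- the bit 1 when t = 2j+1, and * otherwise; dually for x ↦ [x ≤ t].
≥-key : ℕ → ℕ → Cell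
≥-key 0             _       = star
≥-key 1             0       = bit true
≥-key 1             (suc _) = star
≥-key (suc (suc _)) 0       = bullet
≥-key (suc (suc t)) (suc j) = ≥-key t j

≤-key : ℕ → ℕ → Cell
≤-key 0             0       = bit false
≤-key (suc _)       0       = star
≤-key 0             (suc _) = bullet
≤-key 1             (suc _) = bullet
≤-key (suc (suc t)) (suc j) = ≤-key t j

encode-InScen : ∀ x j → InScen *s (encode x j)
encode-InScen 0             0       = *-bit false
encode-InScen 1             0       = *-bit true
encode-InScen (suc (suc _)) 0       = *-star
encode-InScen 0             (suc _) = *-star
encode-InScen 1             (suc _) = *-star
encode-InScen (suc (suc x)) (suc j) = encode-InScen x j

encode-rejects-bullet : ∀ x → T (encode x ⌊ x /2⌋) bullet ≡ false
encode-rejects-bullet 0             = refl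
encode-rejects-bullet 1             = refl
encode-rejects-bullet (suc (suc x)) = encode-rejects-bullet x

≥-key-accepts : ∀ x t j → t ≤ x → T (encode x j) (≥-key t j) ≡ true
≥-key-accepts x             0             j       _ = T-star (encode x j)
≥-key-accepts 1             1             0       _ = refl
≥-key-accepts 1             1             (suc j) _ = refl
≥-key-accepts (suc (suc x)) 1             0       _ = refl
≥-key-accepts (suc (suc x)) 1             (suc j) _ = T-star (encode x j)
≥-key-accepts (suc (suc x)) (suc (suc t)) 0       _ = refl
≥-key-accepts (suc (suc x)) (suc (suc t)) (suc j) (s≤s (s≤s t≤x)) = ≥-key-accepts x t j t≤x
≥-key-accepts 1             (suc (suc t)) j       (s≤s ())

≥-key-rejects : ∀ x t → x < t → T (encode x ⌊ x /2⌋) (≥-key t ⌊ x /2⌋) ≡ false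
≥-key-rejects 0             1             _ = refl
≥-key-rejects 0             (suc (suc t)) _ = refl
≥-key-rejects 1             (suc (suc t)) _ = refl
≥-key-rejects (suc (suc x)) (suc (suc t)) (s≤s (s≤s x<t)) = ≥-key-rejects x t x<t
≥-key-rejects 1             1             (s≤s ())

≤-key-accepts : ∀ x t j → x ≤ t → T (encode x j) (≤-key t j) ≡ true
≤-key-accepts 0             0             0       _ = refl
≤-key-accepts 0             (suc t)       0       _ = refl
≤-key-accepts 1             (suc t)       0       _ = refl
≤-key-accepts (suc (suc x)) (suc t)       0       _ = refl
≤-key-accepts 0             t             (suc j) _ = refl
≤-key-accepts 1             t             (suc j) _ = refl
≤-key-accepts (suc (suc x)) (suc (suc t)) (suc j) (s≤s (s≤s x≤t)) = ≤-key-accepts x t j x≤t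
≤-key-accepts (suc x)       0             j       ()
≤-key-accepts (suc (suc x)) 1             (suc j) (s≤s ())

≤-key-rejects : ∀ x t → t < x → T (encode x ⌊ x /2⌋) (≤-key t ⌊ x /2⌋) ≡ false
≤-key-rejects 1             0             _ = refl
≤-key-rejects (suc (suc x)) 0             _ = encode-rejects-bullet x
≤-key-rejects (suc (suc x)) 1             _ = encode-rejects-bullet x
≤-key-rejects (suc (suc x)) (suc (suc t)) (s≤s (s≤s t<x)) = ≤-key-rejects x t t<x
≤-key-rejects 1             (suc t)       (s≤s ())

m<2n⇒⌊m/2⌋<n : ∀ x m → x < 2 * m → ⌊ x /2⌋ < m
m<2n⇒⌊m/2⌋<n 0             (suc m) _ = s≤s z≤n
m<2n⇒⌊m/2⌋<n 1             (suc m) _ = s≤s z≤n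
m<2n⇒⌊m/2⌋<n (suc (suc x)) (suc m) (s≤s x+1<m+m+1) rewrite +-suc m (m + 0) =
  s≤s (m<2n⇒⌊m/2⌋<n x m (≤-pred x+1<m+m+1))

≤ᵇ≡bigAnd : ∀ n (g : Fin n → Bool) m k →
  (m ≤ k → ∀ j → g j ≡ true) → (k < m → ∃ λ j → g j ≡ false) → (m ≤ᵇ k) ≡ bigAnd n g
≤ᵇ≡bigAnd n g m k all some with m ≤? k
... | yes m≤k = trans (≤ᵇ≡true m≤k) (sym (⇒bigAnd≡true n g (all m≤k)))
... | no m≰k with j , gj ← some (≰⇒> m≰k) =
  trans (≤ᵇ≡false (≰⇒> m≰k)) (sym (⇒bigAnd≡false n g j gj))

InScen-• : ∀ c → InScen •s c
InScen-• (bit b) = •-bit b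
InScen-• star    = •-star
InScen-• bullet  = •-bullet

rejected-at-⌊x/2⌋ : ∀ {n} x → x < 2 * n → (key : ℕ → Cell) →
  T (encode x ⌊ x /2⌋) (key ⌊ x /2⌋) ≡ false →
  ∃ λ (j : Fin n) → T (encode x (toℕ j)) (key (toℕ j)) ≡ false
rejected-at-⌊x/2⌋ {n} x x<2n key rejected =
  fromℕ< cell<n , subst (λ i → T (encode x i) (key i) ≡ false) (sym (toℕ-fromℕ< cell<n)) rejected
  where cell<n = m<2n⇒⌊m/2⌋<n x n x<2n

module _ {q n : ℕ} (q≤2n : q ≤ 2 * n) where

  inputCode : Fin q → Fin n → Cell
  inputCode x j = encode (toℕ x) (toℕ j)

  functionCode : (f : Func q) → GL q f → Fin n → Cell
  functionCode f (t , inj₁ _) j = ≥-key (toℕ t) (toℕ j)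
  functionCode f (t , inj₂ _) j = ≤-key (toℕ t) (toℕ j)

  code-implements : (f : Func q) (p : GL q f) (x : Fin q) →
    f x ≡ bigAnd n (λ j → T (inputCode x j) (functionCode f p j))
  code-implements f (t , inj₁ f≡) x = trans (f≡ x) (≤ᵇ≡bigAnd n _ (toℕ t) (toℕ x)
    (λ t≤x j → ≥-key-accepts (toℕ x) (toℕ t) (toℕ j) t≤x)
    (λ x<t → rejected-at-⌊x/2⌋ (toℕ x) x<2n (≥-key (toℕ t)) (≥-key-rejects (toℕ x) (toℕ t) x<t)))
    where x<2n = <-≤-trans (toℕ<n x) q≤2n
  code-implements f (t , inj₂ f≡) x = trans (f≡ x) (≤ᵇ≡bigAnd n _ (toℕ x) (toℕ t)
    (λ x≤t j → ≤-key-accepts (toℕ x) (toℕ t) (toℕ j) x≤t)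
    (λ t<x → rejected-at-⌊x/2⌋ (toℕ x) x<2n (≤-key (toℕ t)) (≤-key-rejects (toℕ x) (toℕ t) t<x)))
    where x<2n = <-≤-trans (toℕ<n x) q≤2n

  ≤⇒Implementable-GL : Implementable *s •s q n (GL q)
  ≤⇒Implementable-GL =
    inputCode , functionCode , (λ x j → encode-InScen (toℕ x) (toℕ j)) ,
    (λ f p j → InScen-• (functionCode f p j)) , code-implements

InScen-*⇒• : ∀ {c} → InScen *s c → InScen •s c
InScen-*⇒• (*-bit b) = •-bit b
InScen-*⇒• *-star    = •-star

Implementable-*⇒• : ∀ {β q n Φ} → Implementable *s β q n Φ → Implementable •s β q n Φ
Implementable-*⇒• (u , ϑ , u∈ , ϑ∈ , implements) = u , ϑ , (λ x j → InScen-*⇒• (u∈ x j)) , ϑ∈ , implements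

proposition14 : (q n : ℕ) → 2 ≤ q → 1 ≤ n →
    (Implementable *s •s q n (GL q) ⇔ q ≤ 2 * n) ×
    (Implementable •s •s q n (GL q) ⇔ q ≤ 2 * n)
proposition14 q n 2≤q _ =
  mk⇔ (Implementable-GL⇒≤ 2≤q) ≤⇒Implementable-GL ,
  mk⇔ (Implementable-GL⇒≤ 2≤q) (Implementable-*⇒• ∘ ≤⇒Implementable-GL)
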